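{- Let $X\in\{LD,LTD,OLD\}$. Let $G$ be a graph that is either a path $P_n$ or a cycle $C_n$ and that admits an $X$-set. Then $\gamma_X(M(G)) \geq \gamma_X(G)+1$.
   Context: All graphs are finite, simple and connected. For a graph $G=(V,E)$ and $x\in V$, $N(x)$ is the open neighbourhood and $N[x]=N(x)\cup\{x\}$. A set $C\subseteq V$ is dominating if $N[x]\cap C\ne\emptyset$ for all $x\in V$, and total-dominating if $N(x)\cap C\neq\emptyset$ for all $x\in V$. $C$ is a locating-dominating set ($LD$-set) if it is dominating and $N(x)\cap C\ne N(y)\cap C$ for all distinct $x,y\in V\setminus C$; a locating total-dominating set ($LTD$-set) if it is total-dominating and $N(x)\cap C\ne N(y)\cap C$ for all distinct $x,y\in V\setminus C$; an open locating-dominating set ($OLD$-set) if it is total-dominating and $N(x)\cap C\neq N(y)\cap C$ for all distinct $x,y\in V$. For $X\in\{LD,LTD,OLD\}$, $\gamma_X(G)$ is the minimum size of an $X$-set of $G$. $P_n$ is the path on $n$ vertices and $C_n$ ($n\ge 3$) the cycle on $n$ vertices. The Mycielski graph $M(G)$ of $G$ with $V=\{v_1,\dots,v_n\}$ is obtained from $G$ by adding, for each $i$, a new vertex $u_i$ adjacent to every vertex of $N_G(v_i)$, and then adding one further vertex $u$ adjacent to all of $u_1,\dots,u_n$ (and to nothing else). -}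

module Defs where

open import Data.Nat using (ℕ; zero; suc; _+_; _∸_; _≡ᵇ_; _≤_)
open import Data.Bool using (Bool; true; false; _∨_; _∧_; T)
open import Data.Fin using (Fin; toℕ; splitAt)
open import Data.Fin.Subset using (Subset; _∈_; _∩_; ∣_∣)
open import Data.Vec using (tabulate)
open import Data.Sum using (_⊎_; inj₁; inj₂)
open import Data.Product using (_×_; Σ)
open import Relation.Binary.PropositionalEquality using (_≡_; _≢_)
open import Relation.Nullary using (¬_)

record Graph : Set where
  constructor mkGraph
  field
    size : ℕ
    adj  : Fin size → Fin size → Bool
open Graph public

N : (G : Graph) → Fin (size G) → Subset (size G)
N G x = tabulate (adj G x)

N[_] : (G : Graph) → Fin (size G) → Subset (size G)
N[ G ] x = tabulate (λ y → adj G x y ∨ (toℕ x ≡ᵇ toℕ y))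

Meets : ∀ {n} → Subset n → Subset n → Set
Meets {n} A B = Σ (Fin n) λ z → z ∈ A × z ∈ B

Dominating : (G : Graph) → Subset (size G) → Set
Dominating G C = ∀ x → Meets (N[ G ] x) C

TotalDominating : (G : Graph) → Subset (size G) → Set
TotalDominating G C = ∀ x → Meets (N G x) C

data Kind : Set where
  LD LTD OLD : Kind

IsXSet : Kind → (G : Graph) → Subset (size G) → Set
IsXSet LD G C = Dominating G C ×
  (∀ x y → x ≢ y → ¬ (x ∈ C) → ¬ (y ∈ C) → (N G x ∩ C) ≢ (N G y ∩ C))
IsXSet LTD G C = TotalDominating G C ×
  (∀ x y → x ≢ y → ¬ (x ∈ C) → ¬ (y ∈ C) → (N G x ∩ C) ≢ (N G y ∩ C))
IsXSet OLD G C = TotalDominating G C ×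
  (∀ x y → x ≢ y → (N G x ∩ C) ≢ (N G y ∩ C))

IsGamma : Kind → Graph → ℕ → Set
IsGamma X G k =
  Σ (Subset (size G)) (λ C → IsXSet X G C × ∣ C ∣ ≡ k) ×
  (∀ C → IsXSet X G C → k ≤ ∣ C ∣)

pathAdj : ℕ → ℕ → Bool
pathAdj i j = (i ≡ᵇ suc j) ∨ (suc i ≡ᵇ j)

P : ℕ → Graph
P n = mkGraph n (λ i j → pathAdj (toℕ i) (toℕ j))

C : ℕ → Graph
C n = mkGraph n (λ i j → pathAdj (toℕ i) (toℕ j)
                       ∨ ((toℕ i ≡ᵇ 0) ∧ (toℕ j ≡ᵇ n ∸ 1))
                       ∨ ((toℕ j ≡ᵇ 0) ∧ (toℕ i ≡ᵇ n ∸ 1)))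

-- Mycielski graph: vertices Fin (suc (n + n));
-- zero is u, suc (inject i) is v_i, suc (raise n i) is u_i.
data MVert (n : ℕ) : Set where
  vv : Fin n → MVert n
  uu : Fin n → MVert n
  top : MVert n

classify : ∀ {n} → Fin (suc (n + n)) → MVert n
classify Fin.zero = top
classify {n} (Fin.suc i) with splitAt n i
... | inj₁ a = vv a
... | inj₂ b = uu b

madj : (G : Graph) → MVert (size G) → MVert (size G) → Bool
madj G (vv i) (vv j) = adj G i j
madj G (vv i) (uu j) = adj G i j
madj G (uu i) (vv j) = adj G i j
madj G (uu i) (uu j) = false
madj G (uu i) top = true
madj G top (uu j) = true
madj G (vv i) top = false
madj G top (vv j) = false
madj G top top = false

M : Graph → Graph
M G = mkGraph (suc (size G + size G)) (λ x y → madj G (classify x) (classify y))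

-- Let S be a minimum X-set of M(G), with apex u and twin pairs vᵢ, uᵢ. Its projection T to G,
-- the i with vᵢ ∈ S or uᵢ ∈ S, is again an X-set: uᵢ is adjacent to u and exactly to the vⱼ
-- with j ~ i, so two vertices i, j ∉ T with the same trace on T would make uᵢ, uⱼ ∉ S twins
-- on S. If u ∈ S then |T| < |S|. Otherwise u is dominated by some uₐ ∈ S and a is removed
-- from T, choosing a with vₐ ∈ S if possible; a new pair a, j left unseparated would make vₐ
-- a twin of uⱼ or of vⱼ, where an adjacency j ~ a is excluded because every edge of a path or
-- cycle lies in at most one triangle. For OLD, T is S ∩ V plus possibly one neighbour of the
-- only vertex S ∩ V fails to dominate. Since the whole vertex set of M(G) is an X-set,
-- γ_X(M(G)) exists and exceeds γ_X(G).

module Submission where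

open import Defs
open import Data.Nat using (ℕ; zero; suc; _≤_; _<_; _+_; _≡ᵇ_; z≤n; s≤s)
open import Data.Nat.Properties
  using (≤-trans; ≤-reflexive; +-comm; +-suc; +-monoʳ-≤; n≤1+n; m≤m+n; ≮⇒≥; ≡ᵇ⇒≡; ≡⇒≡ᵇ; module ≤-Reasoning)
  renaming (_≟_ to _≟ℕ_)
open import Data.Nat.Induction using (<-rec)
open import Data.Bool using (Bool; true; false; _∨_; _∧_)
open import Data.Bool.Properties
  using (∨-zeroʳ; ∨-conical; ∧-conical; ∧-identityʳ; ∧-zeroʳ; ¬-not; T-≡)
  renaming (_≟_ to _≟ᵇ_)
open import Data.Fin using (Fin; zero; suc; toℕ; fromℕ<; _↑ˡ_; _↑ʳ_; splitAt)
open import Data.Fin.Properties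
  using (any?; all?; ¬∀⟶∃¬; toℕ<n; toℕ-fromℕ<; toℕ-injective; suc-injective;
         splitAt-↑ˡ; splitAt-↑ʳ; splitAt⁻¹-↑ˡ; splitAt⁻¹-↑ʳ; ↑ˡ-injective; ↑ʳ-injective)
  renaming (_≟_ to _≟ᶠ_)
open import Data.Fin.Subset using (Subset; _∈_; _∩_; ∣_∣)
open import Data.Fin.Subset.Properties using (anySubset?; ∣p∣≤∣x∷p∣)
open import Data.Vec using (lookup; tabulate)
open import Data.Vec.Properties
  using (lookup∘tabulate; tabulate∘lookup; tabulate-cong; lookup-zipWith; []=⇒lookup; lookup⇒[]=)
open import Data.Sum using (_⊎_; inj₁; inj₂)
open import Data.Product using (_×_; Σ; _,_; proj₁; proj₂)
open import Data.Empty using (⊥; ⊥-elim)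
open import Function using (_∘_)
open import Function.Bundles using (Equivalence)
open import Relation.Nullary using (¬_; Dec; yes; no)
open import Relation.Nullary.Decidable using (_×-dec_; _⊎-dec_; ¬?; _→-dec_; from-yes)
open import Relation.Binary.PropositionalEquality

true≢false : true ≢ false
true≢false ()

true-or-false : ∀ b → b ≡ true ⊎ b ≡ false
true-or-false true  = inj₁ refl
true-or-false false = inj₂ refl

∨-true⁻ : ∀ a b → a ∨ b ≡ true → a ≡ true ⊎ b ≡ true
∨-true⁻ true  b _ = inj₁ refl
∨-true⁻ false b e = inj₂ e

∨-trueˡ : ∀ {a} b → a ≡ true → a ∨ b ≡ true
∨-trueˡ b refl = refl

∨-trueʳ : ∀ a {b} → b ≡ true → a ∨ b ≡ true
∨-trueʳ a refl = ∨-zeroʳ a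

≡ᵇ-true⇒≡ : ∀ m n → (m ≡ᵇ n) ≡ true → m ≡ n
≡ᵇ-true⇒≡ m n e = ≡ᵇ⇒≡ m n (Equivalence.from T-≡ e)

≡ᵇ-refl : ∀ m → (m ≡ᵇ m) ≡ true
≡ᵇ-refl m = Equivalence.to T-≡ (≡⇒≡ᵇ m m refl)

-- Counting characteristic functions

count : ∀ {m} → (Fin m → Bool) → ℕ
count f = ∣ tabulate f ∣

count-↑ : ∀ m {k} (g : Fin (m + k) → Bool) → count g ≡ count (g ∘ (_↑ˡ k)) + count (g ∘ (m ↑ʳ_))
count-↑ zero    g = refl
count-↑ (suc m) g with g zero | count-↑ m (g ∘ suc)
... | true  | ih = cong suc ih
... | false | ih = ih

count-∨ : ∀ {m} (f g : Fin m → Bool) → count (λ i → f i ∨ g i) ≤ count f + count g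
count-∨ {zero}  f g = z≤n
count-∨ {suc m} f g with f zero | g zero | count-∨ (f ∘ suc) (g ∘ suc)
... | true  | true  | ih = s≤s (≤-trans ih (+-monoʳ-≤ (count (f ∘ suc)) (n≤1+n _)))
... | true  | false | ih = s≤s ih
... | false | true  | ih = ≤-trans (s≤s ih) (≤-reflexive (sym (+-suc (count (f ∘ suc)) _)))
... | false | false | ih = ih

remove : ∀ {m} → (Fin m → Bool) → Fin m → Fin m → Bool
remove f zero    zero    = false
remove f zero    (suc i) = f (suc i)
remove f (suc a) zero    = f zero
remove f (suc a) (suc i) = remove (f ∘ suc) a i

remove-≢ : ∀ {m} (f : Fin m → Bool) {a i} → i ≢ a → remove f a i ≡ f i
remove-≢ f {zero}  {zero}  i≢a = ⊥-elim (i≢a refl)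
remove-≢ f {zero}  {suc i} i≢a = refl
remove-≢ f {suc a} {zero}  i≢a = refl
remove-≢ f {suc a} {suc i} i≢a = remove-≢ (f ∘ suc) (i≢a ∘ cong suc)

remove-count : ∀ {m} (f : Fin m → Bool) a → f a ≡ true → suc (count (remove f a)) ≡ count f
remove-count f zero e rewrite e = refl
remove-count f (suc a) e with f zero | remove-count (f ∘ suc) a e
... | true  | ih = cong suc ih
... | false | ih = ih

count-pos : ∀ {m} (f : Fin m → Bool) a → f a ≡ true → 1 ≤ count f
count-pos f a e = subst (1 ≤_) (remove-count f a e) (s≤s z≤n)

singleton : ∀ {m} → Fin m → Fin m → Bool
singleton zero    zero    = true
singleton zero    (suc i) = false
singleton (suc w) zero    = false
singleton (suc w) (suc i) = singleton w i

singleton-self : ∀ {m} (w : Fin m) → singleton w w ≡ true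
singleton-self zero    = refl
singleton-self (suc w) = singleton-self w

count-singleton : ∀ {m} (w : Fin m) → count (singleton w) ≡ 1
count-singleton {suc m} zero    = cong suc (count-false m)
  where
  count-false : ∀ m → count {m} (λ _ → false) ≡ 0
  count-false zero    = refl
  count-false (suc m) = count-false m
count-singleton (suc w) = count-singleton w

LeastWitness : (ℕ → Set) → Set
LeastWitness Q = Σ ℕ λ k → Q k × (∀ j → Q j → k ≤ j)

least-witness : (Q : ℕ → Set) → (∀ j → Dec (Q j)) → ∀ m → Q m → LeastWitness Q
least-witness Q Q? = <-rec (λ m → Q m → LeastWitness Q) search
  where
  search : ∀ m → (∀ {j} → j < m → Q j → LeastWitness Q) → Q m → LeastWitness Q
  search m rec qm with any? (λ (j : Fin m) → Q? (toℕ j))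
  ... | yes (j , qj) = rec (toℕ<n j) qj
  ... | no none = m , qm , λ j qj → ≮⇒≥ λ j<m → none (fromℕ< j<m , subst Q (sym (toℕ-fromℕ< j<m)) qj)

-- X-sets described by a characteristic function

module _ {n : ℕ} (A : Fin n → Fin n → Bool) (c : Fin n → Bool) where

  NeighbourIn : Fin n → Set
  NeighbourIn x = Σ (Fin n) λ z → A x z ≡ true × c z ≡ true

  Dominatingᶠ : Set
  Dominatingᶠ = ∀ x → c x ≡ true ⊎ NeighbourIn x

  TotalDominatingᶠ : Set
  TotalDominatingᶠ = ∀ x → NeighbourIn x

  SameTrace : Fin n → Fin n → Set
  SameTrace x y = ∀ z → A x z ∧ c z ≡ A y z ∧ c z

  Locatingᶠ : Set
  Locatingᶠ = ∀ x y → x ≢ y → c x ≡ false → c y ≡ false → ¬ SameTrace x y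

  OpenLocatingᶠ : Set
  OpenLocatingᶠ = ∀ x y → x ≢ y → ¬ SameTrace x y

IsXSetᶠ : Kind → ∀ {n} → (Fin n → Fin n → Bool) → (Fin n → Bool) → Set
IsXSetᶠ LD  A c = Dominatingᶠ A c × Locatingᶠ A c
IsXSetᶠ LTD A c = TotalDominatingᶠ A c × Locatingᶠ A c
IsXSetᶠ OLD A c = TotalDominatingᶠ A c × OpenLocatingᶠ A c

SameTrace⇒agree : ∀ {n} (A : Fin n → Fin n → Bool) (c : Fin n → Bool) {x y} →
                  SameTrace A c x y → ∀ z → c z ≡ true → A x z ≡ A y z
SameTrace⇒agree A c {x} {y} same z cz = begin
  A x z          ≡⟨ ∧-identityʳ (A x z) ⟨
  A x z ∧ true   ≡⟨ cong (A x z ∧_) cz ⟨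
  A x z ∧ c z    ≡⟨ same z ⟩
  A y z ∧ c z    ≡⟨ cong (A y z ∧_) cz ⟩
  A y z ∧ true   ≡⟨ ∧-identityʳ (A y z) ⟩
  A y z          ∎
  where open ≡-Reasoning

∧-cong-if : ∀ {a b} s → (s ≡ true → a ≡ b) → a ∧ s ≡ b ∧ s
∧-cong-if {a} {b} true  a≡b = cong (_∧ true) (a≡b refl)
∧-cong-if {a} {b} false _   = trans (∧-zeroʳ a) (sym (∧-zeroʳ b))

module FromSubset (G : Graph) (S : Subset (size G)) (c : Fin (size G) → Bool)
                  (S≗c : ∀ z → lookup S z ≡ c z) where

  ∈⇒true : ∀ {z} → z ∈ S → c z ≡ true
  ∈⇒true {z} z∈S = trans (sym (S≗c z)) ([]=⇒lookup z∈S)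

  true⇒∈ : ∀ {z} → c z ≡ true → z ∈ S
  true⇒∈ {z} e = lookup⇒[]= z S (trans (S≗c z) e)

  ∉⇒false : ∀ {z} → ¬ (z ∈ S) → c z ≡ false
  ∉⇒false {z} z∉S with true-or-false (c z)
  ... | inj₁ e = ⊥-elim (z∉S (true⇒∈ e))
  ... | inj₂ e = e

  false⇒∉ : ∀ {z} → c z ≡ false → ¬ (z ∈ S)
  false⇒∉ e z∈S = true≢false (trans (sym (∈⇒true z∈S)) e)

  lookup-trace : ∀ x z → lookup (N G x ∩ S) z ≡ adj G x z ∧ c z
  lookup-trace x z = trans (lookup-zipWith _∧_ z (N G x) S)
                           (cong₂ _∧_ (lookup∘tabulate (adj G x) z) (S≗c z))

  ≡⇒SameTrace : ∀ x y → N G x ∩ S ≡ N G y ∩ S → SameTrace (adj G) c x y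
  ≡⇒SameTrace x y e z = trans (sym (lookup-trace x z)) (trans (cong (λ v → lookup v z) e) (lookup-trace y z))

  SameTrace⇒≡ : ∀ x y → SameTrace (adj G) c x y → N G x ∩ S ≡ N G y ∩ S
  SameTrace⇒≡ x y same = begin
    N G x ∩ S                           ≡⟨ tabulate∘lookup (N G x ∩ S) ⟨
    tabulate (lookup (N G x ∩ S))       ≡⟨ tabulate-cong (λ z → trans (lookup-trace x z)
                                                          (trans (same z) (sym (lookup-trace y z)))) ⟩
    tabulate (lookup (N G y ∩ S))       ≡⟨ tabulate∘lookup (N G y ∩ S) ⟩
    N G y ∩ S                           ∎
    where open ≡-Reasoning

  lookup-closed : ∀ x z → lookup (N[ G ] x) z ≡ adj G x z ∨ (toℕ x ≡ᵇ toℕ z)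
  lookup-closed x z = lookup∘tabulate _ z

  lookup-open : ∀ x z → lookup (N G x) z ≡ adj G x z
  lookup-open x z = lookup∘tabulate _ z

  Dominating⇒ᶠ : Dominating G S → Dominatingᶠ (adj G) c
  Dominating⇒ᶠ dom x with dom x
  ... | z , z∈N[x] , z∈S with ∨-true⁻ (adj G x z) _ (trans (sym (lookup-closed x z)) ([]=⇒lookup z∈N[x]))
  ... | inj₁ xz = inj₂ (z , xz , ∈⇒true z∈S)
  ... | inj₂ x≡z with toℕ-injective (≡ᵇ-true⇒≡ (toℕ x) (toℕ z) x≡z)
  ... | refl = inj₁ (∈⇒true z∈S)

  ᶠ⇒Dominating : Dominatingᶠ (adj G) c → Dominating G S
  ᶠ⇒Dominating dom x with dom x
  ... | inj₁ cx = x , lookup⇒[]= x _ (trans (lookup-closed x x) (∨-trueʳ (adj G x x) (≡ᵇ-refl (toℕ x)))) , true⇒∈ cx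
  ... | inj₂ (z , xz , cz) = z , lookup⇒[]= z _ (trans (lookup-closed x z) (∨-trueˡ _ xz)) , true⇒∈ cz

  TotalDominating⇒ᶠ : TotalDominating G S → TotalDominatingᶠ (adj G) c
  TotalDominating⇒ᶠ dom x with dom x
  ... | z , z∈N , z∈S = z , trans (sym (lookup-open x z)) ([]=⇒lookup z∈N) , ∈⇒true z∈S

  ᶠ⇒TotalDominating : TotalDominatingᶠ (adj G) c → TotalDominating G S
  ᶠ⇒TotalDominating dom x with dom x
  ... | z , xz , cz = z , lookup⇒[]= z _ (trans (lookup-open x z) xz) , true⇒∈ cz

  Locating⇒ᶠ : (∀ x y → x ≢ y → ¬ (x ∈ S) → ¬ (y ∈ S) → (N G x ∩ S) ≢ (N G y ∩ S)) → Locatingᶠ (adj G) c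
  Locating⇒ᶠ loc x y x≢y cx cy same = loc x y x≢y (false⇒∉ cx) (false⇒∉ cy) (SameTrace⇒≡ x y same)

  ᶠ⇒Locating : Locatingᶠ (adj G) c → (∀ x y → x ≢ y → ¬ (x ∈ S) → ¬ (y ∈ S) → (N G x ∩ S) ≢ (N G y ∩ S))
  ᶠ⇒Locating loc x y x≢y x∉S y∉S e = loc x y x≢y (∉⇒false x∉S) (∉⇒false y∉S) (≡⇒SameTrace x y e)

  IsXSet⇒ᶠ : ∀ X → IsXSet X G S → IsXSetᶠ X (adj G) c
  IsXSet⇒ᶠ LD  (dom , loc) = Dominating⇒ᶠ dom , Locating⇒ᶠ loc
  IsXSet⇒ᶠ LTD (dom , loc) = TotalDominating⇒ᶠ dom , Locating⇒ᶠ loc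
  IsXSet⇒ᶠ OLD (dom , loc) = TotalDominating⇒ᶠ dom , λ x y x≢y → loc x y x≢y ∘ SameTrace⇒≡ x y

  ᶠ⇒IsXSet : ∀ X → IsXSetᶠ X (adj G) c → IsXSet X G S
  ᶠ⇒IsXSet LD  (dom , loc) = ᶠ⇒Dominating dom , ᶠ⇒Locating loc
  ᶠ⇒IsXSet LTD (dom , loc) = ᶠ⇒TotalDominating dom , ᶠ⇒Locating loc
  ᶠ⇒IsXSet OLD (dom , loc) = ᶠ⇒TotalDominating dom , λ x y x≢y → loc x y x≢y ∘ ≡⇒SameTrace x y

IsXSet⇒ᶠ : ∀ X G {S : Subset (size G)} → IsXSet X G S → IsXSetᶠ X (adj G) (lookup S)
IsXSet⇒ᶠ X G {S} = FromSubset.IsXSet⇒ᶠ G S (lookup S) (λ _ → refl) X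

ᶠ⇒IsXSet-tabulate : ∀ X G {c : Fin (size G) → Bool} → IsXSetᶠ X (adj G) c → IsXSet X G (tabulate c)
ᶠ⇒IsXSet-tabulate X G {c} = FromSubset.ᶠ⇒IsXSet G (tabulate c) c (lookup∘tabulate c) X

module _ {n : ℕ} (A : Fin n → Fin n → Bool) (c : Fin n → Bool) where

  NeighbourIn? : ∀ x → Dec (NeighbourIn A c x)
  NeighbourIn? x = any? λ z → (A x z ≟ᵇ true) ×-dec (c z ≟ᵇ true)

  SameTrace? : ∀ x y → Dec (SameTrace A c x y)
  SameTrace? x y = all? λ z → (A x z ∧ c z) ≟ᵇ (A y z ∧ c z)

  Locatingᶠ? : Dec (Locatingᶠ A c)
  Locatingᶠ? = all? λ x → all? λ y →
    ¬? (x ≟ᶠ y) →-dec ((c x ≟ᵇ false) →-dec ((c y ≟ᵇ false) →-dec ¬? (SameTrace? x y)))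

  OpenLocatingᶠ? : Dec (OpenLocatingᶠ A c)
  OpenLocatingᶠ? = all? λ x → all? λ y → ¬? (x ≟ᶠ y) →-dec ¬? (SameTrace? x y)

  IsXSetᶠ? : ∀ X → Dec (IsXSetᶠ X A c)
  IsXSetᶠ? LD  = all? (λ x → (c x ≟ᵇ true) ⊎-dec NeighbourIn? x) ×-dec Locatingᶠ?
  IsXSetᶠ? LTD = all? NeighbourIn? ×-dec Locatingᶠ?
  IsXSetᶠ? OLD = all? NeighbourIn? ×-dec OpenLocatingᶠ?

IsXSet? : ∀ X G (S : Subset (size G)) → Dec (IsXSet X G S)
IsXSet? X G S with IsXSetᶠ? (adj G) (lookup S) X
... | yes p = yes (FromSubset.ᶠ⇒IsXSet G S (lookup S) (λ _ → refl) X p)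
... | no ¬p = no (¬p ∘ IsXSet⇒ᶠ X G)

γ-exists : ∀ X H → Σ (Subset (size H)) (IsXSet X H) → Σ ℕ (IsGamma X H)
γ-exists X H (S₀ , S₀-X) with least-witness HasXSetOfSize HasXSetOfSize? ∣ S₀ ∣ (S₀ , S₀-X , refl)
  where
  HasXSetOfSize : ℕ → Set
  HasXSetOfSize j = Σ (Subset (size H)) λ S → IsXSet X H S × ∣ S ∣ ≡ j
  HasXSetOfSize? : ∀ j → Dec (HasXSetOfSize j)
  HasXSetOfSize? j = anySubset? λ S → IsXSet? X H S ×-dec (∣ S ∣ ≟ℕ j)
... | k , witness , least = k , witness , λ S S-X → least ∣ S ∣ (S , S-X , refl)

_⊆ᶠ_ : ∀ {n} → (Fin n → Bool) → (Fin n → Bool) → Set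
d ⊆ᶠ e = ∀ k → d k ≡ true → e k ≡ true

⊆ᶠ-false : ∀ {n} {d e : Fin n → Bool} → d ⊆ᶠ e → ∀ {k} → e k ≡ false → d k ≡ false
⊆ᶠ-false {d = d} d⊆e {k} ek with true-or-false (d k)
... | inj₁ dk = ⊥-elim (true≢false (trans (sym (d⊆e k dk)) ek))
... | inj₂ dk = dk

module _ {n : ℕ} (A : Fin n → Fin n → Bool) {d e : Fin n → Bool} (d⊆e : d ⊆ᶠ e) where

  TotalDominatingᶠ-mono : TotalDominatingᶠ A d → TotalDominatingᶠ A e
  TotalDominatingᶠ-mono dom x with dom x
  ... | z , xz , dz = z , xz , d⊆e z dz

  SameTrace-anti : ∀ {x y} → SameTrace A e x y → SameTrace A d x y
  SameTrace-anti same z = ∧-cong-if (d z) λ dz → SameTrace⇒agree A e same z (d⊆e z dz)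

  IsXSetᶠ-mono : ∀ X → IsXSetᶠ X A d → IsXSetᶠ X A e
  IsXSetᶠ-mono LD  (dom , loc) = dominating , locating
    where
    dominating : Dominatingᶠ A e
    dominating x with dom x
    ... | inj₁ dx             = inj₁ (d⊆e x dx)
    ... | inj₂ (z , xz , dz)  = inj₂ (z , xz , d⊆e z dz)
    locating : Locatingᶠ A e
    locating x y x≢y ex ey = loc x y x≢y (⊆ᶠ-false d⊆e ex) (⊆ᶠ-false d⊆e ey) ∘ SameTrace-anti
  IsXSetᶠ-mono LTD (dom , loc) =
    TotalDominatingᶠ-mono dom , λ x y x≢y ex ey → loc x y x≢y (⊆ᶠ-false d⊆e ex) (⊆ᶠ-false d⊆e ey) ∘ SameTrace-anti
  IsXSetᶠ-mono OLD (dom , loc) = TotalDominatingᶠ-mono dom , λ x y x≢y → loc x y x≢y ∘ SameTrace-anti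

full : ∀ {n} → Fin n → Bool
full _ = true

Irreflexive : ∀ {n} → (Fin n → Fin n → Bool) → Set
Irreflexive A = ∀ i → A i i ≡ false

EdgesInAtMostOneTriangle : ∀ {n} → (Fin n → Fin n → Bool) → Set
EdgesInAtMostOneTriangle A =
  ∀ a b c d → A b a ≡ true → A a c ≡ true → A b c ≡ true → A a d ≡ true → A b d ≡ true → c ≡ d

-- The Mycielski graph

module Mycielski (G : Graph) where

  n : ℕ
  n = size G

  A : Fin n → Fin n → Bool
  A = adj G

  Aᴹ : Fin (suc (n + n)) → Fin (suc (n + n)) → Bool
  Aᴹ = adj (M G)

  apex : Fin (suc (n + n))
  apex = zero

  v u : Fin n → Fin (suc (n + n))
  v i = suc (i ↑ˡ n)
  u i = suc (n ↑ʳ i)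

  classify-v : ∀ i → classify (v i) ≡ vv i
  classify-v i rewrite splitAt-↑ˡ n i n = refl

  classify-u : ∀ i → classify (u i) ≡ uu i
  classify-u i rewrite splitAt-↑ʳ n n i = refl

  data Vertex : Fin (suc (n + n)) → Set where
    is-apex : Vertex apex
    is-v    : ∀ i → Vertex (v i)
    is-u    : ∀ i → Vertex (u i)

  vertex : ∀ z → Vertex z
  vertex zero = is-apex
  vertex (suc j) with splitAt n j in eq
  ... | inj₁ i rewrite sym (splitAt⁻¹-↑ˡ eq) = is-v i
  ... | inj₂ i rewrite sym (splitAt⁻¹-↑ʳ eq) = is-u i

  v-injective : ∀ {i j} → v i ≡ v j → i ≡ j
  v-injective = ↑ˡ-injective n _ _ ∘ suc-injective

  u-injective : ∀ {i j} → u i ≡ u j → i ≡ j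
  u-injective = ↑ʳ-injective n _ _ ∘ suc-injective

  v≢u : ∀ {i j} → v i ≢ u j
  v≢u {i} {j} e with trans (sym (classify-v i)) (trans (cong classify e) (classify-u j))
  ... | ()

  adj-v-v : ∀ i j → Aᴹ (v i) (v j) ≡ A i j
  adj-v-v i j rewrite classify-v i | classify-v j = refl

  adj-v-u : ∀ i j → Aᴹ (v i) (u j) ≡ A i j
  adj-v-u i j rewrite classify-v i | classify-u j = refl

  adj-u-v : ∀ i j → Aᴹ (u i) (v j) ≡ A i j
  adj-u-v i j rewrite classify-u i | classify-v j = refl

  adj-u-u : ∀ i j → Aᴹ (u i) (u j) ≡ false
  adj-u-u i j rewrite classify-u i | classify-u j = refl

  adj-u-apex : ∀ i → Aᴹ (u i) apex ≡ true
  adj-u-apex i rewrite classify-u i = refl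

  adj-apex-u : ∀ i → Aᴹ apex (u i) ≡ true
  adj-apex-u i rewrite classify-u i = refl

  adj-v-apex : ∀ i → Aᴹ (v i) apex ≡ false
  adj-v-apex i rewrite classify-v i = refl

  adj-apex-v : ∀ i → Aᴹ apex (v i) ≡ false
  adj-apex-v i rewrite classify-v i = refl

  module Traces (c : Fin (suc (n + n)) → Bool) where

    cV cU : Fin n → Bool
    cV = c ∘ v
    cU = c ∘ u

    count-V+U≤ : count cV + count cU ≤ count c
    count-V+U≤ = ≤-trans (≤-reflexive (sym (count-↑ n (c ∘ suc)))) (∣p∣≤∣x∷p∣ (c apex) (tabulate (c ∘ suc)))

    count-V+U< : c apex ≡ true → count cV + count cU < count c
    count-V+U< c-apex rewrite c-apex = s≤s (≤-reflexive (sym (count-↑ n (c ∘ suc))))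

    Agree : Fin n → Fin n → (Fin n → Bool) → Set
    Agree x y t = ∀ k → t k ≡ true → A x k ≡ A y k

    SameTrace-u-u : ∀ {x y} → Agree x y cV → SameTrace Aᴹ c (u x) (u y)
    SameTrace-u-u {x} {y} agree z with vertex z
    ... | is-apex rewrite adj-u-apex x | adj-u-apex y = refl
    ... | is-v k  rewrite adj-u-v x k  | adj-u-v y k  = ∧-cong-if (cV k) (agree k)
    ... | is-u k  rewrite adj-u-u x k  | adj-u-u y k  = refl

    SameTrace-v-v : ∀ {x y} → Agree x y cV → Agree x y cU → SameTrace Aᴹ c (v x) (v y)
    SameTrace-v-v {x} {y} agreeV agreeU z with vertex z
    ... | is-apex rewrite adj-v-apex x | adj-v-apex y = refl
    ... | is-v k  rewrite adj-v-v x k  | adj-v-v y k  = ∧-cong-if (cV k) (agreeV k)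
    ... | is-u k  rewrite adj-v-u x k  | adj-v-u y k  = ∧-cong-if (cU k) (agreeU k)

    SameTrace-v-u : ∀ {x y} → c apex ≡ false → Agree x y cV → (∀ k → A x k ∧ cU k ≡ false) →
                    SameTrace Aᴹ c (v x) (u y)
    SameTrace-v-u {x} {y} apex∉ agree x∉U z with vertex z
    ... | is-apex rewrite adj-v-apex x | adj-u-apex y = sym apex∉
    ... | is-v k  rewrite adj-v-v x k  | adj-u-v y k  = ∧-cong-if (cV k) (agree k)
    ... | is-u k  rewrite adj-v-u x k  | adj-u-u y k  = x∉U k

    neighbourIn-v : ∀ {x} → NeighbourIn Aᴹ c (v x) → Σ (Fin n) λ k → A x k ≡ true × (cV k ≡ true ⊎ cU k ≡ true)
    neighbourIn-v {x} (z , xz , cz) with vertex z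
    ... | is-apex = ⊥-elim (true≢false (trans (sym xz) (adj-v-apex x)))
    ... | is-v k  = k , trans (sym (adj-v-v x k)) xz , inj₁ cz
    ... | is-u k  = k , trans (sym (adj-v-u x k)) xz , inj₂ cz

    neighbourIn-u : ∀ {x} → NeighbourIn Aᴹ c (u x) → c apex ≡ true ⊎ NeighbourIn A cV x
    neighbourIn-u {x} (z , xz , cz) with vertex z
    ... | is-apex = inj₁ cz
    ... | is-v k  = inj₂ (k , trans (sym (adj-u-v x k)) xz , cz)
    ... | is-u k  = ⊥-elim (true≢false (trans (sym xz) (adj-u-u x k)))

    neighbourIn-apex : NeighbourIn Aᴹ c apex → Σ (Fin n) λ k → cU k ≡ true
    neighbourIn-apex (z , az , cz) with vertex z
    ... | is-apex = ⊥-elim (true≢false (sym az))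
    ... | is-v k  = ⊥-elim (true≢false (trans (sym az) (adj-apex-v k)))
    ... | is-u k  = k , cz

    Smaller : Kind → Set
    Smaller X = Σ (Fin n → Bool) λ t → IsXSetᶠ X A t × count t < count c

    u-dominated-by-V : ∀ {j} → c apex ≡ false → NeighbourIn Aᴹ c (u j) → NeighbourIn A cV j
    u-dominated-by-V apex∉ nbr with neighbourIn-u nbr
    ... | inj₁ apex∈ = ⊥-elim (true≢false (trans (sym apex∈) apex∉))
    ... | inj₂ k     = k

    count-V< : ∀ {a} → cU a ≡ true → count cV < count c
    count-V< {a} ua = ≤-trans (≤-reflexive (+-comm 1 (count cV))) (≤-trans (+-monoʳ-≤ (count cV) (count-pos cU a ua)) count-V+U≤)

    projection : Fin n → Bool
    projection i = cV i ∨ cU i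

    projection-without : Fin n → Fin n → Bool
    projection-without a i = cV i ∨ remove cU a i

    count-projection< : c apex ≡ true → count projection < count c
    count-projection< apex∈ = ≤-trans (s≤s (count-∨ cV cU)) (count-V+U< apex∈)

    count-projection-without< : ∀ {a} → cU a ≡ true → count (projection-without a) < count c
    count-projection-without< {a} ua =
      ≤-trans (s≤s (count-∨ cV (remove cU a)))
              (≤-trans (≤-reflexive (trans (sym (+-suc (count cV) _)) (cong (count cV +_) (remove-count cU a ua))))
                       count-V+U≤)

    outside-projection-without : ∀ {a x} → projection-without a x ≡ false → x ≡ a ⊎ cU x ≡ false
    outside-projection-without {a} {x} tx with x ≟ᶠ a
    ... | yes x≡a = inj₁ x≡a
    ... | no  x≢a = inj₂ (trans (sym (remove-≢ cU x≢a)) (proj₂ ∨-conical (cV x) _ tx))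

    module _ (loc : Locatingᶠ Aᴹ c) where

      u-separated : ∀ {t} → cV ⊆ᶠ t →
                    ∀ {x y} → x ≢ y → cU x ≡ false → cU y ≡ false → ¬ SameTrace A t x y
      u-separated V⊆t x≢y ux uy same =
        loc (u _) (u _) (x≢y ∘ u-injective) ux uy
            (SameTrace-u-u λ k vk → SameTrace⇒agree A _ same k (V⊆t k vk))

      projection-locating : Locatingᶠ A projection
      projection-locating x y x≢y tx ty =
        u-separated (λ k → ∨-trueˡ (cU k)) x≢y (proj₂ ∨-conical (cV x) _ tx) (proj₂ ∨-conical (cV y) _ ty)

      projection-without-locating-if-v : ∀ {a} → cV a ≡ true → Locatingᶠ A (projection-without a)
      projection-without-locating-if-v {a} va x y x≢y tx ty =
        u-separated (λ k → ∨-trueˡ _) x≢y (outside-U tx) (outside-U ty)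
        where
        outside-U : ∀ {x} → projection-without a x ≡ false → cU x ≡ false
        outside-U {x} tx with outside-projection-without {a} tx
        ... | inj₁ refl = ⊥-elim (true≢false (trans (sym va) (proj₁ ∨-conical (cV a) _ tx)))
        ... | inj₂ ux   = ux

      module _ (irr : Irreflexive A) (tri : EdgesInAtMostOneTriangle A) (apex∉ : c apex ≡ false)
               (U-dominated : ∀ j → cU j ≡ false → NeighbourIn A cV j)
               (never-both : ∀ b → cU b ≡ true → cV b ≡ false)
               {a : Fin n} (ua : cU a ≡ true) where

        module _ {j : Fin n} (j≢a : j ≢ a) (vj : cV j ≡ false) (uj : cU j ≡ false)
                 (same : SameTrace A (projection-without a) a j) where

          agree-V : Agree a j cV
          agree-V k vk = SameTrace⇒agree A _ same k (∨-trueˡ _ vk)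

          without-U-neighbour : (∀ k → A a k ∧ cU k ≡ false) → ⊥
          without-U-neighbour a∉U = loc (v a) (u j) v≢u (never-both a ua) uj (SameTrace-v-u apex∉ agree-V a∉U)

          with-U-neighbour : ∀ {b} → A a b ≡ true → cU b ≡ true → ⊥
          with-U-neighbour {b} ab ub =
            loc (v a) (v j) (j≢a ∘ sym ∘ v-injective) (never-both a ua) vj (SameTrace-v-v agree-V agree-U)
            where
            b≢a : b ≢ a
            b≢a refl = true≢false (trans (sym ab) (irr a))

            jb : A j b ≡ true
            jb = trans (sym (SameTrace⇒agree A _ same b (∨-trueʳ (cV b) (trans (remove-≢ cU b≢a) ub)))) ab

            -- If j ~ a, the neighbour vₖ ∈ S of uⱼ makes b and k common neighbours of a and j, so k = b.
            j≁a : A j a ≡ false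
            j≁a with true-or-false (A j a)
            ... | inj₂ ja≡false = ja≡false
            ... | inj₁ ja with U-dominated j uj
            ... | k , jk , vk with tri a j b k ja ab jb (trans (agree-V k vk) jk) jk
            ... | refl = ⊥-elim (true≢false (trans (sym vk) (never-both b ub)))

            agree-U : Agree a j cU
            agree-U k uk with k ≟ᶠ a
            ... | yes refl = trans (irr a) (sym j≁a)
            ... | no  k≢a  = SameTrace⇒agree A _ same k (∨-trueʳ (cV k) (trans (remove-≢ cU k≢a) uk))

          removed-vertex-separated : ⊥
          removed-vertex-separated with all? (λ k → (A a k ∧ cU k) ≟ᵇ false)
          ... | yes a∉U = without-U-neighbour a∉U
          ... | no  a∈U with ¬∀⟶∃¬ n _ (λ k → (A a k ∧ cU k) ≟ᵇ false) a∈U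
          ... | b , ab∧ub = with-U-neighbour (proj₁ ∧-conical _ _ (¬-not ab∧ub)) (proj₂ ∧-conical _ _ (¬-not ab∧ub))

        projection-without-locating-if-never-both : Locatingᶠ A (projection-without a)
        projection-without-locating-if-never-both x y x≢y tx ty
          with outside-projection-without {a} tx | outside-projection-without {a} ty
        ... | inj₂ ux   | inj₂ uy   = u-separated (λ k → ∨-trueˡ _) x≢y ux uy
        ... | inj₁ refl | inj₂ uy   = λ same → removed-vertex-separated (x≢y ∘ sym) (proj₁ ∨-conical _ _ ty) uy same
        ... | inj₂ ux   | inj₁ refl = λ same → removed-vertex-separated x≢y (proj₁ ∨-conical _ _ tx) ux (sym ∘ same)
        ... | inj₁ refl | inj₁ refl = λ _ → x≢y refl

      projection-without-locating : Irreflexive A → EdgesInAtMostOneTriangle A → c apex ≡ false →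
                                    (∀ j → cU j ≡ false → NeighbourIn A cV j) → ∀ {a₀} → cU a₀ ≡ true →
                                    Σ (Fin n) λ a → cU a ≡ true × Locatingᶠ A (projection-without a)
      projection-without-locating irr tri apex∉ U-dominated {a₀} ua₀
        with any? (λ a → (cU a ≟ᵇ true) ×-dec (cV a ≟ᵇ true))
      ... | yes (a , ua , va) = a , ua , projection-without-locating-if-v va
      ... | no  none = a₀ , ua₀ , projection-without-locating-if-never-both irr tri apex∉ U-dominated never-both ua₀
        where
        never-both : ∀ b → cU b ≡ true → cV b ≡ false
        never-both b ub with true-or-false (cV b)
        ... | inj₁ vb = ⊥-elim (none (b , ub , vb))
        ... | inj₂ vb = vb

    projection-neighbour : ∀ {x} → Σ (Fin n) (λ k → A x k ≡ true × (cV k ≡ true ⊎ cU k ≡ true)) →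
                           NeighbourIn A projection x
    projection-neighbour (k , xk , inj₁ vk) = k , xk , ∨-trueˡ _ vk
    projection-neighbour (k , xk , inj₂ uk) = k , xk , ∨-trueʳ (cV k) uk

    projection-dominating : Dominatingᶠ Aᴹ c → Dominatingᶠ A projection
    projection-dominating dom x with true-or-false (projection x)
    ... | inj₁ px = inj₁ px
    ... | inj₂ px with dom (v x)
    ... | inj₁ vx  = ⊥-elim (true≢false (trans (sym vx) (proj₁ ∨-conical _ _ px)))
    ... | inj₂ nbr = inj₂ (projection-neighbour (neighbourIn-v nbr))

    projection-total-dominating : TotalDominatingᶠ Aᴹ c → TotalDominatingᶠ A projection
    projection-total-dominating tdom x = projection-neighbour (neighbourIn-v (tdom (v x)))

    U-dominated-if-dominating : c apex ≡ false → Dominatingᶠ Aᴹ c → ∀ j → cU j ≡ false → NeighbourIn A cV j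
    U-dominated-if-dominating apex∉ dom j uj with dom (u j)
    ... | inj₁ uj≡true = ⊥-elim (true≢false (trans (sym uj≡true) uj))
    ... | inj₂ nbr     = u-dominated-by-V apex∉ nbr

    projection-without-dominating : Irreflexive A → c apex ≡ false → Dominatingᶠ Aᴹ c →
                                    ∀ {a} → Dominatingᶠ A (projection-without a)
    projection-without-dominating irr apex∉ dom {a} x with true-or-false (projection-without a x)
    ... | inj₁ tx = inj₁ tx
    ... | inj₂ tx with outside-projection-without {a} tx
    ... | inj₂ ux with U-dominated-if-dominating apex∉ dom x ux
    ... | k , xk , vk = inj₂ (k , xk , ∨-trueˡ _ vk)
    projection-without-dominating irr apex∉ dom {a} x | inj₂ tx | inj₁ refl with dom (v a)
    ... | inj₁ va  = ⊥-elim (true≢false (trans (sym va) (proj₁ ∨-conical _ _ tx)))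
    ... | inj₂ nbr with neighbourIn-v nbr
    ... | k , ak , inj₁ vk = inj₂ (k , ak , ∨-trueˡ _ vk)
    ... | k , ak , inj₂ uk = inj₂ (k , ak , ∨-trueʳ (cV k) (trans (remove-≢ cU k≢a) uk))
      where
      k≢a : k ≢ a
      k≢a refl = true≢false (trans (sym ak) (irr a))

    shrink-LD : Irreflexive A → EdgesInAtMostOneTriangle A → IsXSetᶠ LD Aᴹ c → Smaller LD
    shrink-LD irr tri (dom , loc) with true-or-false (c apex)
    ... | inj₁ apex∈ = projection , (projection-dominating dom , projection-locating loc) , count-projection< apex∈
    ... | inj₂ apex∉ with dom apex
    ... | inj₁ apex∈ = ⊥-elim (true≢false (trans (sym apex∈) apex∉))
    ... | inj₂ nbr with projection-without-locating loc irr tri apex∉ (U-dominated-if-dominating apex∉ dom)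
                          (proj₂ (neighbourIn-apex nbr))
    ... | a , ua , locating = projection-without a , (projection-without-dominating irr apex∉ dom {a} , locating) ,
                              count-projection-without< ua

    V-total-dominating : c apex ≡ false → TotalDominatingᶠ Aᴹ c → TotalDominatingᶠ A cV
    V-total-dominating apex∉ tdom j = u-dominated-by-V apex∉ (tdom (u j))

    shrink-LTD : Irreflexive A → EdgesInAtMostOneTriangle A → IsXSetᶠ LTD Aᴹ c → Smaller LTD
    shrink-LTD irr tri (tdom , loc) with true-or-false (c apex)
    ... | inj₁ apex∈ = projection , (projection-total-dominating tdom , projection-locating loc) , count-projection< apex∈
    ... | inj₂ apex∉ with projection-without-locating loc irr tri apex∉ (λ j _ → V-total-dominating apex∉ tdom j)
                            (proj₂ (neighbourIn-apex (tdom apex)))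
    ... | a , ua , locating =
      projection-without a ,
      (TotalDominatingᶠ-mono A (λ k → ∨-trueˡ _) (V-total-dominating apex∉ tdom) , locating) ,
      count-projection-without< ua

    module _ (tdom : TotalDominatingᶠ Aᴹ c) (loc : OpenLocatingᶠ Aᴹ c) where

      V-open-locating : ∀ {t} → cV ⊆ᶠ t → OpenLocatingᶠ A t
      V-open-locating V⊆t x y x≢y same =
        loc (u x) (u y) (x≢y ∘ u-injective) (SameTrace-u-u λ k vk → SameTrace⇒agree A _ same k (V⊆t k vk))

      undominated-unique : ∀ {x y} → ¬ NeighbourIn A cV x → ¬ NeighbourIn A cV y → x ≡ y
      undominated-unique {x} {y} ¬x ¬y with x ≟ᶠ y
      ... | yes x≡y = x≡y
      ... | no  x≢y = ⊥-elim (loc (u x) (u y) (x≢y ∘ u-injective)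
                                  (SameTrace-u-u λ k vk → trans (non-adjacent ¬x k vk) (sym (non-adjacent ¬y k vk))))
        where
        non-adjacent : ∀ {x} → ¬ NeighbourIn A cV x → ∀ k → cV k ≡ true → A x k ≡ false
        non-adjacent {x} ¬x k vk with true-or-false (A x k)
        ... | inj₁ xk = ⊥-elim (¬x (k , xk , vk))
        ... | inj₂ xk = xk

      shrink-OLD : Smaller OLD
      shrink-OLD with true-or-false (c apex)
      ... | inj₂ apex∉ = cV , (V-total-dominating apex∉ tdom , V-open-locating (λ _ vk → vk)) ,
                         count-V< (proj₂ (neighbourIn-apex (tdom apex)))
      ... | inj₁ apex∈ with all? (NeighbourIn? A cV)
      ... | yes V-dominating = cV , (V-dominating , V-open-locating (λ _ vk → vk)) ,
                               ≤-trans (s≤s (m≤m+n (count cV) (count cU))) (count-V+U< apex∈)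
      ... | no ¬V-dominating with ¬∀⟶∃¬ n _ (NeighbourIn? A cV) ¬V-dominating
      ... | i , ¬i with neighbourIn-v (tdom (v i))
      ... | k , ik , inj₁ vk = ⊥-elim (¬i (k , ik , vk))
      ... | k , ik , inj₂ uk = t , (t-dominating , V-open-locating (λ _ → ∨-trueˡ _)) , count-t
        where
        t : Fin n → Bool
        t x = cV x ∨ singleton k x

        t-dominating : TotalDominatingᶠ A t
        t-dominating x with NeighbourIn? A cV x
        ... | yes (k′ , xk′ , vk′) = k′ , xk′ , ∨-trueˡ _ vk′
        ... | no  ¬x with undominated-unique ¬x ¬i
        ... | refl = k , ik , ∨-trueʳ (cV k) (singleton-self k)

        count-t : count t < count c
        count-t = begin-strict
          count t                         ≤⟨ count-∨ cV (singleton k) ⟩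
          count cV + count (singleton k)  ≡⟨ cong (count cV +_) (count-singleton k) ⟩
          count cV + 1                    ≤⟨ +-monoʳ-≤ (count cV) (count-pos cU k uk) ⟩
          count cV + count cU             <⟨ count-V+U< apex∈ ⟩
          count c                         ∎
          where open ≤-Reasoning

    shrink : ∀ X → Irreflexive A → EdgesInAtMostOneTriangle A → IsXSetᶠ X Aᴹ c → Smaller X
    shrink LD  irr tri S-X           = shrink-LD irr tri S-X
    shrink LTD irr tri S-X           = shrink-LTD irr tri S-X
    shrink OLD _   _   (tdom , loc)  = shrink-OLD tdom loc

  full-total-dominating : Fin n → TotalDominatingᶠ A full → TotalDominatingᶠ Aᴹ full
  full-total-dominating w tdom z with vertex z
  ... | is-apex = u w , adj-apex-u w , refl
  ... | is-v i  = v (proj₁ (tdom i)) , trans (adj-v-v i _) (proj₁ (proj₂ (tdom i))) , refl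
  ... | is-u i  = v (proj₁ (tdom i)) , trans (adj-u-v i _) (proj₁ (proj₂ (tdom i))) , refl

  full-open-locating : TotalDominatingᶠ A full → OpenLocatingᶠ A full → OpenLocatingᶠ Aᴹ full
  full-open-locating tdom loc x y x≢y same = separated (vertex x) (vertex y) x≢y agree
    where
    agree : ∀ z → Aᴹ x z ≡ Aᴹ y z
    agree z = SameTrace⇒agree Aᴹ full {x} {y} same z refl

    differ : ∀ x y z → Aᴹ x z ≡ false → Aᴹ y z ≡ true → ¬ (∀ z → Aᴹ x z ≡ Aᴹ y z)
    differ _ _ z xz yz agree = true≢false (trans (sym yz) (trans (sym (agree z)) xz))

    ¬agree-sym : ∀ x y → ¬ (∀ z → Aᴹ x z ≡ Aᴹ y z) → ¬ (∀ z → Aᴹ y z ≡ Aᴹ x z)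
    ¬agree-sym _ _ ¬agree agree = ¬agree (sym ∘ agree)

    v-vs-apex : ∀ i → ¬ (∀ z → Aᴹ apex z ≡ Aᴹ (v i) z)
    v-vs-apex i = differ apex (v i) (v k) (adj-apex-v k) (trans (adj-v-v i k) ik)
      where
      k = proj₁ (tdom i)
      ik = proj₁ (proj₂ (tdom i))

    in-G : ∀ {i j} → i ≢ j → ¬ (∀ z → A i z ≡ A j z)
    in-G i≢j agree = loc _ _ i≢j λ z → cong (_∧ true) (agree z)

    separated : ∀ {x y} → Vertex x → Vertex y → x ≢ y → ¬ (∀ z → Aᴹ x z ≡ Aᴹ y z)
    separated is-apex  is-apex  x≢y _ = x≢y refl
    separated is-apex  (is-v j) _     = v-vs-apex j
    separated is-apex  (is-u j) _     = differ apex (u j) apex refl (adj-u-apex j)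
    separated (is-v i) is-apex  _     = ¬agree-sym apex (v i) (v-vs-apex i)
    separated (is-v i) (is-v j) x≢y   = λ agree → in-G (x≢y ∘ cong v) λ z →
                                          trans (sym (adj-v-v i z)) (trans (agree (v z)) (adj-v-v j z))
    separated (is-v i) (is-u j) _     = differ (v i) (u j) apex (adj-v-apex i) (adj-u-apex j)
    separated (is-u i) is-apex  _     = ¬agree-sym apex (u i) (differ apex (u i) apex refl (adj-u-apex i))
    separated (is-u i) (is-v j) _     = ¬agree-sym (v j) (u i) (differ (v j) (u i) apex (adj-v-apex j) (adj-u-apex i))
    separated (is-u i) (is-u j) x≢y   = λ agree → in-G (x≢y ∘ cong u) λ z →
                                          trans (sym (adj-u-v i z)) (trans (agree (v z)) (adj-u-v j z))

  full-IsXSetᶠ : ∀ X → Fin n → IsXSetᶠ X A full → IsXSetᶠ X Aᴹ full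
  full-IsXSetᶠ LD  _ _             = (λ _ → inj₁ refl) , λ _ _ _ ()
  full-IsXSetᶠ LTD w (tdom , _)    = full-total-dominating w tdom , λ _ _ _ ()
  full-IsXSetᶠ OLD w (tdom , loc)  = full-total-dominating w tdom , full-open-locating tdom loc

module _ (X : Kind) (G : Graph) where
  open Mycielski G using (full-IsXSetᶠ; module Traces)

  M-has-XSet : Fin (size G) → Σ (Subset (size G)) (IsXSet X G) → Σ (Subset (size (M G))) (IsXSet X (M G))
  M-has-XSet w (D , D-X) =
    tabulate full , ᶠ⇒IsXSet-tabulate X (M G) (full-IsXSetᶠ X w (IsXSetᶠ-mono (adj G) (λ _ _ → refl) X (IsXSet⇒ᶠ X G D-X)))

  M-XSet-shrinks : Irreflexive (adj G) → EdgesInAtMostOneTriangle (adj G) → ∀ {S} → IsXSet X (M G) S →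
                   Σ (Subset (size G)) λ T → IsXSet X G T × ∣ T ∣ < ∣ S ∣
  M-XSet-shrinks irr tri {S} S-X with Traces.shrink (lookup S) X irr tri (IsXSet⇒ᶠ X (M G) S-X)
  ... | t , t-X , t<S = tabulate t , ᶠ⇒IsXSet-tabulate X G t-X , subst (count t <_) (cong ∣_∣ (tabulate∘lookup S)) t<S

  γ-M≥γ+1 : Fin (size G) → Irreflexive (adj G) → EdgesInAtMostOneTriangle (adj G) →
            Σ (Subset (size G)) (IsXSet X G) → ∀ k → IsGamma X G k → Σ ℕ λ m → IsGamma X (M G) m × k + 1 ≤ m
  γ-M≥γ+1 w irr tri G-X k (_ , k-least) with γ-exists X (M G) (M-has-XSet w G-X)
  ... | m , γ@((S , S-X , ∣S∣≡m) , _) with M-XSet-shrinks irr tri S-X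
  ... | T , T-X , T<S = m , γ , (begin
    k + 1     ≡⟨ +-comm k 1 ⟩
    suc k     ≤⟨ s≤s (k-least T T-X) ⟩
    suc ∣ T ∣ ≤⟨ T<S ⟩
    ∣ S ∣     ≡⟨ ∣S∣≡m ⟩
    m         ∎)
    where open ≤-Reasoning

-- Paths and cycles

data Step : ℕ → ℕ → Set where
  down : ∀ j → Step (suc j) j
  up   : ∀ i → Step i (suc i)

pathAdj⇒Step : ∀ x y → pathAdj x y ≡ true → Step x y
pathAdj⇒Step x y e with ∨-true⁻ (x ≡ᵇ suc y) _ e
... | inj₁ x≡1+y rewrite ≡ᵇ-true⇒≡ x (suc y) x≡1+y      = down y
... | inj₂ 1+x≡y rewrite sym (≡ᵇ-true⇒≡ (suc x) y 1+x≡y) = up x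

Step-irrefl : ∀ {x} → ¬ Step x x
Step-irrefl ()

Step-triangle-free : ∀ {a b c} → Step b a → Step a c → Step b c → ⊥
Step-triangle-free (down _) (down _) ()
Step-triangle-free (down _) (up _)   ()
Step-triangle-free (up _)   (down _) ()
Step-triangle-free (up _)   (up _)   ()

data CycleStep (last : ℕ) : ℕ → ℕ → Set where
  step   : ∀ {x y} → Step x y → CycleStep last x y
  wrap   : CycleStep last 0 last
  unwrap : CycleStep last last 0

cycleAdj⇒CycleStep : ∀ last x y →
  (pathAdj x y ∨ ((x ≡ᵇ 0) ∧ (y ≡ᵇ last)) ∨ ((y ≡ᵇ 0) ∧ (x ≡ᵇ last))) ≡ true → CycleStep last x y
cycleAdj⇒CycleStep last x y e with ∨-true⁻ (pathAdj x y) _ e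
... | inj₁ xy = step (pathAdj⇒Step x y xy)
... | inj₂ e′ with ∨-true⁻ ((x ≡ᵇ 0) ∧ (y ≡ᵇ last)) _ e′
... | inj₁ e″ rewrite ≡ᵇ-true⇒≡ x 0 (proj₁ ∧-conical _ _ e″) | ≡ᵇ-true⇒≡ y last (proj₂ ∧-conical _ _ e″) = wrap
... | inj₂ e″ rewrite ≡ᵇ-true⇒≡ y 0 (proj₁ ∧-conical _ _ e″) | ≡ᵇ-true⇒≡ x last (proj₂ ∧-conical _ _ e″) = unwrap

CycleStep-irrefl : ∀ {l x} → ¬ CycleStep (suc l) x x
CycleStep-irrefl (step ())

CycleStep-triangle-free : ∀ {m a b c} → let last = suc (suc (suc m)) in
  CycleStep last b a → CycleStep last a c → CycleStep last b c → ⊥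
CycleStep-triangle-free (step ba) (step ac) (step bc) = Step-triangle-free ba ac bc
CycleStep-triangle-free wrap (step ()) (step (up _))
CycleStep-triangle-free unwrap (step (up _)) (step ())
CycleStep-triangle-free (step ()) wrap (step (down _))
CycleStep-triangle-free (step ()) wrap (step (up _))
CycleStep-triangle-free (step ()) unwrap (step (down _))
CycleStep-triangle-free (step (up _)) (step ()) wrap
CycleStep-triangle-free wrap (step ()) wrap
CycleStep-triangle-free (step (down _)) (step ()) unwrap
CycleStep-triangle-free (step (up _)) (step ()) unwrap
CycleStep-triangle-free unwrap (step ()) unwrap

TriangleFree : ∀ {n} → (Fin n → Fin n → Bool) → Set
TriangleFree A = ∀ a b c → A b a ≡ true → A a c ≡ true → A b c ≡ true → ⊥

TriangleFree⇒EdgesInAtMostOneTriangle : ∀ {n} (A : Fin n → Fin n → Bool) → TriangleFree A → EdgesInAtMostOneTriangle A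
TriangleFree⇒EdgesInAtMostOneTriangle _ triangle-free a b c _ ba ac bc _ _ = ⊥-elim (triangle-free a b c ba ac bc)

P-irreflexive : ∀ n → Irreflexive (adj (P n))
P-irreflexive n i = ¬-not (Step-irrefl ∘ pathAdj⇒Step (toℕ i) (toℕ i))

P-triangle-free : ∀ n → TriangleFree (adj (P n))
P-triangle-free n a b c ba ac bc = Step-triangle-free
  (pathAdj⇒Step (toℕ b) (toℕ a) ba) (pathAdj⇒Step (toℕ a) (toℕ c) ac) (pathAdj⇒Step (toℕ b) (toℕ c) bc)

C-irreflexive : ∀ m → Irreflexive (adj (C (suc (suc m))))
C-irreflexive m i = ¬-not (CycleStep-irrefl ∘ cycleAdj⇒CycleStep (suc m) (toℕ i) (toℕ i))

C-triangle-free : ∀ m → TriangleFree (adj (C (suc (suc (suc (suc m))))))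
C-triangle-free m a b c ba ac bc = CycleStep-triangle-free
  (cycleAdj⇒CycleStep _ (toℕ b) (toℕ a) ba) (cycleAdj⇒CycleStep _ (toℕ a) (toℕ c) ac)
  (cycleAdj⇒CycleStep _ (toℕ b) (toℕ c) bc)

C₃-edges-in-one-triangle : EdgesInAtMostOneTriangle (adj (C 3))
C₃-edges-in-one-triangle = from-yes decided
  where
  A = adj (C 3)
  decided = all? λ a → all? λ b → all? λ c → all? λ d →
    (A b a ≟ᵇ true) →-dec ((A a c ≟ᵇ true) →-dec ((A b c ≟ᵇ true) →-dec
    ((A a d ≟ᵇ true) →-dec ((A b d ≟ᵇ true) →-dec (c ≟ᶠ d)))))

C-edges-in-one-triangle : ∀ m → EdgesInAtMostOneTriangle (adj (C (3 + m)))
C-edges-in-one-triangle zero    = C₃-edges-in-one-triangle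
C-edges-in-one-triangle (suc m) =
  TriangleFree⇒EdgesInAtMostOneTriangle (adj (C (4 + m))) (C-triangle-free m)

theorem1 : (X : Kind) (n : ℕ) (G : Graph) →
    ((1 ≤ n × G ≡ P n) ⊎ (3 ≤ n × G ≡ C n)) →
    Σ (Subset (size G)) (IsXSet X G) →
    (k : ℕ) → IsGamma X G k →
    Σ ℕ (λ m → IsGamma X (M G) m × k + 1 ≤ m)
theorem1 X (suc n) _ (inj₁ (_ , refl)) =
  γ-M≥γ+1 X (P (suc n)) zero (P-irreflexive (suc n))
    (TriangleFree⇒EdgesInAtMostOneTriangle (adj (P (suc n))) (P-triangle-free (suc n)))
theorem1 X (suc (suc (suc m))) _ (inj₂ (s≤s (s≤s (s≤s z≤n)) , refl)) =
  γ-M≥γ+1 X (C (3 + m)) zero (C-irreflexive (suc m)) (C-edges-in-one-triangle m)
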